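{- Let $A$ be an $m \times n$ array ($m,n\ge1$) over a finite alphabet. For $0\le i<m$ let $r_i$ be the primitive root of the word $A[i,0..n-1]$ (row $i$), and for $0 \le j < n$ let $c_j$ be the primitive root of the word $A[0..m-1,j]$ (column $j$). Then the primitive root of $A$ has dimension $p\times q$, where $q = \operatorname{lcm}(|r_0|, |r_1|, \ldots, |r_{m-1}|)$ and $p = \operatorname{lcm}(|c_0|, |c_1|, \ldots, |c_{n-1}|)$.
   Context: Arrays are indexed from $0$; $A[i..j,k..\ell]$ denotes the subarray with rows $i$ through $j$ and columns $k$ through $\ell$. For a nonempty word $x$, its primitive root is the shortest word $z$ with $x = z^e$ for some integer $e\ge1$; $|z|$ is its length. For an $m\times n$ array $A$ and positive integers $p,q$, $A^{p\times q}$ is the $pm \times qn$ array $B$ with $B[i,j] = A[i \bmod m, j \bmod n]$. A nonempty array $M$ is primitive if $M = B^{p\times q}$ with $p,q$ positive integers implies $p=q=1$. Every nonempty array $A$ can be written as $A = C^{i\times j}$ for a unique primitive array $C$ and positive integers $i,j$; this $C$ is called the primitive root of $A$. -}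

module Defs where

open import Data.Nat using (ℕ; zero; suc; _+_; _*_; _≤_)
open import Data.Nat.LCM using (lcm)
open import Data.Fin using (Fin; toℕ)
open import Data.Product using (Σ; _×_)
open import Relation.Binary.PropositionalEquality using (_≡_)
import Data.Vec.Functional as VF

Word : Set → ℕ → Set
Word S n = Fin n → S

Array : Set → ℕ → ℕ → Set
Array S m n = Fin m → Fin n → S

-- x = z^e  (z of length d, x of length n): n = e * d and x[i] = z[i mod d].
-- "i mod d = i'" is expressed as  i = k * d + i'  with i' < d.
IsWordPower : {S : Set} {n d : ℕ} → Word S n → Word S d → ℕ → Set
IsWordPower {n = n} {d = d} x z e =
  (n ≡ e * d) ×
  (∀ (i : Fin n) (i' : Fin d) (k : ℕ) → toℕ i ≡ k * d + toℕ i' → x i ≡ z i')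

IsPrimitiveRootLength : {S : Set} {n : ℕ} → Word S n → ℕ → Set
IsPrimitiveRootLength {S} x d =
  (Σ (Word S d) λ z → Σ ℕ λ e → (1 ≤ e) × IsWordPower x z e) ×
  (∀ (d' : ℕ) (z' : Word S d') (e' : ℕ) → 1 ≤ e' → IsWordPower x z' e' → d ≤ d')

IsArrayPower : {S : Set} {m n m' n' : ℕ} → Array S m n → Array S m' n' → ℕ → ℕ → Set
IsArrayPower {m = m} {n = n} {m' = m'} {n' = n'} A B p q =
  (m ≡ p * m') × (n ≡ q * n') ×
  (∀ (i : Fin m) (j : Fin n) (i' : Fin m') (j' : Fin n') (k l : ℕ) →
     toℕ i ≡ k * m' + toℕ i' → toℕ j ≡ l * n' + toℕ j' → A i j ≡ B i' j')

IsPrimitiveArray : {S : Set} {m n : ℕ} → Array S m n → Set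
IsPrimitiveArray {S} {m} {n} M =
  (1 ≤ m) × (1 ≤ n) ×
  (∀ (m' n' : ℕ) (B : Array S m' n') (p q : ℕ) → 1 ≤ p → 1 ≤ q →
     IsArrayPower M B p q → (p ≡ 1) × (q ≡ 1))

row : {S : Set} {m n : ℕ} → Array S m n → Fin m → Word S n
row A i = λ j → A i j

col : {S : Set} {m n : ℕ} → Array S m n → Fin n → Word S m
col A j = λ i → A i j

lcmOf : {k : ℕ} → (Fin k → ℕ) → ℕ
lcmOf f = VF.foldr lcm 1 f

module Submission where

-- Proof idea.  Work with one dimension at a time: the height statement
-- p = lcm |c_j| is the width statement q = lcm |r_i| for the transposed
-- array, so it suffices to prove the latter.
--
-- Extend a nonempty word x of length n cyclically to a sequence
-- ℕ → S.  Then x = z^e (|z| = d) holds exactly when d ∣ n and d is a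
-- period of that sequence.  Periods of a sequence are closed under gcd
-- (Bézout), so the primitive root length r of x divides the length of every
-- word whose power is x: gcd r d is again a root length and r is minimal.
--
-- If A = C^{e×f}, every row of A is an f-th power of a row of C,
-- so every |r_i| divides q and hence L = lcm |r_i| divides q, say q = t L.
-- Every row of C is a window of the cyclic extension of a row of A, which
-- has period |r_i| and hence L; therefore C is the 1 × t power of its first
-- L columns, and primitivity of C forces t = 1.

open import Defs
open import Data.Nat using (ℕ; zero; suc; _+_; _*_; _≤_; _<_; NonZero; _%_; _/_; >-nonZero; >-nonZero⁻¹)
open import Data.Nat.Properties
open import Data.Nat.DivMod
open import Data.Nat.Divisibility
open import Data.Nat.GCD
open import Data.Nat.LCM
open import Data.Fin using (Fin; toℕ; fromℕ<; inject≤; zero; suc)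
open import Data.Fin.Properties using (toℕ-fromℕ<; toℕ-injective; toℕ<n; toℕ-inject≤)
open import Data.Product using (_×_; _,_; proj₁; proj₂; swap)
open import Relation.Binary.PropositionalEquality
open import Relation.Nullary using (contradiction)
open ≡-Reasoning

factors-nonZero : ∀ {n} e d → 1 ≤ n → n ≡ e * d → NonZero e × NonZero d
factors-nonZero e d n≥1 refl =
  m*n≢0⇒m≢0 e {{>-nonZero n≥1}} , m*n≢0⇒n≢0 e {{>-nonZero n≥1}}

factor-≤ : ∀ {n} e d → 1 ≤ e → n ≡ e * d → d ≤ n
factor-≤ e d e≥1 refl = m≤n*m d e {{>-nonZero e≥1}}

small-decomposition : ∀ {a b p} k → a < p → a ≡ k * p + b → a ≡ b
small-decomposition zero    _   a≡ = a≡
small-decomposition {a} {b} {p} (suc k) a<p a≡ =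
  contradiction (subst (p ≤_) (sym (trans a≡ (+-assoc p (k * p) b))) (m≤m+n p _)) (<⇒≱ a<p)

mod-decomposition : ∀ k d .{{_ : NonZero d}} → k ≡ k / d * d + toℕ (k mod d)
mod-decomposition k d = begin
  k                         ≡⟨ m≡m%n+[m/n]*n k d ⟩
  k % d + k / d * d         ≡⟨ +-comm (k % d) (k / d * d) ⟩
  k / d * d + k % d         ≡⟨ cong (k / d * d +_) (sym (toℕ-fromℕ< _)) ⟩
  k / d * d + toℕ (k mod d) ∎

lcmOf-upper : ∀ {k} (g : Fin k → ℕ) (i : Fin k) → g i ∣ lcmOf g
lcmOf-upper g zero    = m∣lcm[m,n] _ _
lcmOf-upper g (suc i) = ∣-trans (lcmOf-upper (λ j → g (suc j)) i) (n∣lcm[m,n] (g zero) _)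

lcmOf-least : ∀ {k} (g : Fin k → ℕ) {c} → (∀ i → g i ∣ c) → lcmOf g ∣ c
lcmOf-least {zero}  g {c} _ = 1∣ c
lcmOf-least {suc k} g     h = lcm-least (h zero) (lcmOf-least (λ i → g (suc i)) (λ i → h (suc i)))

Period : {S : Set} → (ℕ → S) → ℕ → Set
Period F d = ∀ k → F (k + d) ≡ F k

module _ {S : Set} {F : ℕ → S} where

  period-multiple : ∀ {d} → Period F d → ∀ a k → F (k + a * d) ≡ F k
  period-multiple     per zero    k = cong F (+-identityʳ k)
  period-multiple {d} per (suc a) k = begin
    F (k + (d + a * d)) ≡⟨ cong F (trans (cong (k +_) (+-comm d (a * d))) (sym (+-assoc k (a * d) d))) ⟩
    F (k + a * d + d)   ≡⟨ per (k + a * d) ⟩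
    F (k + a * d)       ≡⟨ period-multiple per a k ⟩
    F k                 ∎

  period-∣ : ∀ {d L} → Period F d → d ∣ L → Period F L
  period-∣ per (divides a refl) = period-multiple per a

  -- The gcd of two periods is a period: by Bézout, g + b d₂ = a d₁ (or
  -- symmetrically), and shifting by multiples of a period changes nothing.
  period-gcd : ∀ {d₁ d₂} → Period F d₁ → Period F d₂ → Period F (gcd d₁ d₂)
  period-gcd {d₁} {d₂} per₁ per₂ k with Bézout.identity (gcd-GCD d₁ d₂)
  ... | Bézout.Identity.+- a b eq = begin
    F (k + gcd d₁ d₂)          ≡⟨ sym (period-multiple per₂ b _) ⟩
    F (k + gcd d₁ d₂ + b * d₂) ≡⟨ cong F (trans (+-assoc k _ (b * d₂)) (cong (k +_) eq)) ⟩
    F (k + a * d₁)             ≡⟨ period-multiple per₁ a k ⟩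
    F k                        ∎
  ... | Bézout.Identity.-+ a b eq = begin
    F (k + gcd d₁ d₂)          ≡⟨ sym (period-multiple per₁ a _) ⟩
    F (k + gcd d₁ d₂ + a * d₁) ≡⟨ cong F (trans (+-assoc k _ (a * d₁)) (cong (k +_) eq)) ⟩
    F (k + b * d₂)             ≡⟨ period-multiple per₂ b k ⟩
    F k                        ∎

power-lookup : ∀ {S : Set} {n d e} {x : Word S n} {z : Word S d} → IsWordPower x z e →
  .{{_ : NonZero d}} → ∀ i → x i ≡ z (toℕ i mod d)
power-lookup {d = d} (_ , entries) i = entries i _ (toℕ i / d) (mod-decomposition (toℕ i) d)

module NonemptyWord {S : Set} {n : ℕ} (x : Word S n) (n≥1 : 1 ≤ n) where

  instance
    n≢0 : NonZero n
    n≢0 = >-nonZero n≥1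

  cyclic : ℕ → S
  cyclic k = x (k mod n)

  cyclic-extends : ∀ i → cyclic (toℕ i) ≡ x i
  cyclic-extends i = cong x (toℕ-injective (trans (toℕ-fromℕ< _) (m<n⇒m%n≡m (toℕ<n i))))

  power⇒period : ∀ {d e} {z : Word S d} → IsWordPower x z e → Period cyclic d
  power⇒period {d} {e} {z} pow k = begin
    cyclic (k + d)                ≡⟨ power-lookup {e = e} pow _ ⟩
    z (toℕ ((k + d) mod n) mod d) ≡⟨ cong z (toℕ-injective (trans (toℕ-fromℕ< _) (trans residues (sym (toℕ-fromℕ< _))))) ⟩
    z (toℕ (k mod n) mod d)       ≡⟨ sym (power-lookup {e = e} pow _) ⟩
    cyclic k                      ∎
    where
    instance
      d≢0 : NonZero d
      d≢0 = proj₂ (factors-nonZero e d n≥1 (proj₁ pow))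
    d∣n : d ∣ n
    d∣n = divides e (proj₁ pow)
    residues : toℕ ((k + d) mod n) % d ≡ toℕ (k mod n) % d
    residues = begin
      toℕ ((k + d) mod n) % d ≡⟨ cong (_% d) (toℕ-fromℕ< _) ⟩
      (k + d) % n % d         ≡⟨ m∣n⇒o%n%m≡o%m d n (k + d) d∣n ⟩
      (k + d) % d             ≡⟨ [m+n]%n≡m%n k d ⟩
      k % d                   ≡⟨ sym (m∣n⇒o%n%m≡o%m d n k d∣n) ⟩
      k % n % d               ≡⟨ cong (_% d) (sym (toℕ-fromℕ< _)) ⟩
      toℕ (k mod n) % d       ∎

  period⇒power : ∀ {d e} → n ≡ e * d → Period cyclic d →
    IsWordPower x (λ s → cyclic (toℕ s)) e
  period⇒power {d} n≡ed per = n≡ed , λ i s t i≡ → begin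
    x i                    ≡⟨ sym (cyclic-extends i) ⟩
    cyclic (toℕ i)         ≡⟨ cong cyclic (trans i≡ (+-comm (t * d) (toℕ s))) ⟩
    cyclic (toℕ s + t * d) ≡⟨ period-multiple per t (toℕ s) ⟩
    cyclic (toℕ s)         ∎

  -- The primitive root length divides the length of every word whose power
  -- is x: the gcd of both lengths is a period dividing n, hence itself a
  -- root length, and the primitive root is the shortest one.
  root-divides : ∀ {r d f} {w : Word S d} → IsPrimitiveRootLength x r →
    IsWordPower x w f → r ∣ d
  root-divides {r} {d} {f} ((_ , e , _ , root) , shortest) pow =
    subst (_∣ d) (sym r≡g) (gcd[m,n]∣n r d)
    where
    instance
      r≢0 : NonZero r
      r≢0 = proj₂ (factors-nonZero e r n≥1 (proj₁ root))
    g∣n : gcd r d ∣ n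
    g∣n = ∣-trans (gcd[m,n]∣m r d) (divides e (proj₁ root))
    r≤g : r ≤ gcd r d
    r≤g with g∣n
    ... | divides t n≡tg =
      shortest _ _ t (>-nonZero⁻¹ t {{proj₁ (factors-nonZero t _ n≥1 n≡tg)}})
        (period⇒power {e = t} n≡tg (period-gcd (power⇒period {e = e} root) (power⇒period {e = f} pow)))
    r≡g : r ≡ gcd r d
    r≡g = ≤-antisym r≤g (∣⇒≤ (gcd[m,n]∣m r d))

open NonemptyWord using (cyclic; cyclic-extends; power⇒period; root-divides)

row-of-power : ∀ {S : Set} {m n p q e f} {A : Array S m n} {C : Array S p q} →
  IsArrayPower A C e f → ∀ i i' k → toℕ i ≡ k * p + toℕ i' → IsWordPower (row A i) (row C i') f
row-of-power (_ , n≡fq , entries) i i' k i≡ = n≡fq , λ j j' l j≡ → entries i j i' j' k l i≡ j≡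

periodic-rows⇒power : ∀ {S : Set} {p q L t} (C : Array S p q) (F : Fin p → ℕ → S) →
  (∀ i j → C i j ≡ F i (toℕ j)) → (∀ i → Period (F i) L) →
  (L≤q : L ≤ q) → q ≡ t * L → IsArrayPower C (λ i j' → C i (inject≤ j' L≤q)) 1 t
periodic-rows⇒power {p = p} {L = L} C F window per L≤q q≡tL =
  sym (*-identityˡ p) , q≡tL , entries
  where
  entries : ∀ i j i' j' k l → toℕ i ≡ k * p + toℕ i' → toℕ j ≡ l * L + toℕ j' →
    C i j ≡ C i' (inject≤ j' L≤q)
  entries i j i' j' k l i≡ j≡ = begin
    C i j                        ≡⟨ cong (λ u → C u j) (toℕ-injective (small-decomposition k (toℕ<n i) i≡)) ⟩
    C i' j                       ≡⟨ window i' j ⟩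
    F i' (toℕ j)                 ≡⟨ cong (F i') (trans j≡ (+-comm (l * L) (toℕ j'))) ⟩
    F i' (toℕ j' + l * L)        ≡⟨ period-multiple (per i') l (toℕ j') ⟩
    F i' (toℕ j')                ≡⟨ cong (F i') (sym (toℕ-inject≤ j' L≤q)) ⟩
    F i' (toℕ (inject≤ j' L≤q))  ≡⟨ sym (window i' _) ⟩
    C i' (inject≤ j' L≤q)        ∎

width-of-primitive-root : ∀ {S : Set} {m n p q e f} (A : Array S m n) → 1 ≤ n →
  (r : Fin m → ℕ) → (∀ i → IsPrimitiveRootLength (row A i) (r i)) →
  (C : Array S p q) → 1 ≤ e → 1 ≤ f → IsPrimitiveArray C → IsArrayPower A C e f →
  q ≡ lcmOf r
width-of-primitive-root {S} {m} {n} {p} {q} {e} {f} A n≥1 r roots C e≥1 f≥1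
                        (p≥1 , q≥1 , prim) pow@(m≡ep , n≡fq , entries) =
  begin q ≡⟨ q≡tL ⟩ t * L ≡⟨ cong (_* L) t≡1 ⟩ 1 * L ≡⟨ *-identityˡ L ⟩ L ∎
  where
  instance
    p≢0 : NonZero p
    p≢0 = >-nonZero p≥1
    q≢0 : NonZero q
    q≢0 = >-nonZero q≥1
  L : ℕ
  L = lcmOf r
  -- Row i of A is a power of row (i mod p) of C, whose length is q.
  r∣q : ∀ i → r i ∣ q
  r∣q i = root-divides (row A i) n≥1 {f = f} (roots i)
            (row-of-power {e = e} {f = f} pow i (toℕ i mod p) (toℕ i / p) (mod-decomposition (toℕ i) p))
  L∣q : L ∣ q
  L∣q = lcmOf-least r r∣q
  t : ℕ
  t = _∣_.quotient L∣q
  q≡tL : q ≡ t * L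
  q≡tL = _∣_.equality L∣q
  p≤m : p ≤ m
  p≤m = factor-≤ e p e≥1 m≡ep
  q≤n : q ≤ n
  q≤n = factor-≤ f q f≥1 n≡fq
  F : Fin p → ℕ → S
  F i = cyclic (row A (inject≤ i p≤m)) n≥1
  window : ∀ i j → C i j ≡ F i (toℕ j)
  window i j = begin
    C i j                                      ≡⟨ sym (entries _ _ i j 0 0 (toℕ-inject≤ i p≤m) (toℕ-inject≤ j q≤n)) ⟩
    A (inject≤ i p≤m) (inject≤ j q≤n)          ≡⟨ sym (cyclic-extends (row A _) n≥1 _) ⟩
    F i (toℕ (inject≤ j q≤n))                  ≡⟨ cong (F i) (toℕ-inject≤ j q≤n) ⟩
    F i (toℕ j)                                ∎
  period-L : ∀ i → Period (F i) L
  period-L i with roots (inject≤ i p≤m)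
  ... | (_ , e' , _ , root) , _ =
    period-∣ (power⇒period (row A _) n≥1 {e = e'} root) (lcmOf-upper r (inject≤ i p≤m))
  t≡1 : t ≡ 1
  t≡1 = proj₂ (prim p L _ 1 t ≤-refl
                 (>-nonZero⁻¹ t {{proj₁ (factors-nonZero t L q≥1 q≡tL)}})
                 (periodic-rows⇒power {t = t} C F window period-L (∣⇒≤ L∣q) q≡tL))

transpose : ∀ {S : Set} {m n} → Array S m n → Array S n m
transpose A j i = A i j

transpose-power : ∀ {S : Set} {m n p q e f} {A : Array S m n} {C : Array S p q} →
  IsArrayPower A C e f → IsArrayPower (transpose A) (transpose C) f e
transpose-power (m≡ep , n≡fq , entries) =
  n≡fq , m≡ep , λ j i j' i' l k j≡ i≡ → entries i j i' j' k l i≡ j≡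

transpose-primitive : ∀ {S : Set} {m n} {C : Array S m n} →
  IsPrimitiveArray C → IsPrimitiveArray (transpose C)
transpose-primitive (m≥1 , n≥1 , prim) =
  n≥1 , m≥1 , λ n' m' B q p q≥1 p≥1 pow →
    swap (prim m' n' (transpose B) p q p≥1 q≥1 (transpose-power {e = q} {f = p} pow))

lemma14 : (k m n : ℕ) → 1 ≤ m → 1 ≤ n → (A : Array (Fin k) m n) →
    (r : Fin m → ℕ) → (∀ i → IsPrimitiveRootLength (row A i) (r i)) →
    (c : Fin n → ℕ) → (∀ j → IsPrimitiveRootLength (col A j) (c j)) →
    (p q : ℕ) (C : Array (Fin k) p q) (e f : ℕ) → 1 ≤ e → 1 ≤ f →
    IsPrimitiveArray C → IsArrayPower A C e f →
    (p ≡ lcmOf c) × (q ≡ lcmOf r)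
lemma14 _ m n m≥1 n≥1 A r rows c cols p q C e f e≥1 f≥1 prim pow =
  width-of-primitive-root (transpose A) m≥1 c cols (transpose C) f≥1 e≥1
    (transpose-primitive prim) (transpose-power {e = e} {f = f} pow)
  , width-of-primitive-root A n≥1 r rows C e≥1 f≥1 prim pow
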